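{- Let $m\geq 3$ be odd and let $n\equiv 0\pmod 4$. Then the Cayley graph $\mathrm{Cay}(\mathbb{Z}_m\times\mathbb{Z}_n,\ \{\pm1\}\times\{\pm n/4,\ n/2\})$ can be decomposed into three $C_m$-factors.
   Context: For a finite additive group $\Gamma$ and a subset $S\subseteq\Gamma\setminus\{0\}$ closed under negatives, the Cayley graph $\mathrm{Cay}(\Gamma,S)$ has vertex set $\Gamma$ and an edge between $a$ and $b$ whenever $a-b\in S$. Here $\{\pm1\}\times T$ denotes the set of pairs $(\epsilon,t)$ with $\epsilon\in\{1,-1\}\subseteq\mathbb{Z}_m$ and $t\in T\subseteq\mathbb{Z}_n$. A $C_k$-factor of a graph is a spanning subgraph each of whose components is a cycle of length $k$; decomposing a graph into factors means partitioning its edge set into the edge sets of these factors. -}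

module Defs where

open import Data.Nat using (ℕ; _+_; _∸_; NonZero)
open import Data.Nat.DivMod using (_%_; _/_; m%n<n)
open import Data.Fin using (Fin; toℕ; fromℕ<)
open import Data.Product using (_×_; _,_; Σ-syntax; ∃; ∃-syntax; ∃!)
open import Data.Sum using (_⊎_)
open import Relation.Binary.PropositionalEquality using (_≡_)

module _ (k : ℕ) .{{_ : NonZero k}} where

  ι : ℕ → Fin k
  ι x = fromℕ< (m%n<n x k)

  _⊕_ : Fin k → Fin k → Fin k
  a ⊕ b = ι (toℕ a + toℕ b)

  ⊖_ : Fin k → Fin k
  ⊖ a = ι (k ∸ toℕ a)

  _⊝_ : Fin k → Fin k → Fin k
  a ⊝ b = a ⊕ (⊖ b)

Γ : ℕ → ℕ → Set
Γ m n = Fin m × Fin n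

sub : (m n : ℕ) .{{_ : NonZero m}} .{{_ : NonZero n}} → Γ m n → Γ m n → Γ m n
sub m n (a₁ , a₂) (b₁ , b₂) = (_⊝_ m a₁ b₁) , (_⊝_ n a₂ b₂)

Cay : (m n : ℕ) .{{_ : NonZero m}} .{{_ : NonZero n}} →
      (Γ m n → Set) → Γ m n → Γ m n → Set
Cay m n S a b = S (sub m n a b)

S-pm1×T : (m n : ℕ) .{{_ : NonZero m}} .{{_ : NonZero n}} → Γ m n → Set
S-pm1×T m n (e , t) =
  (e ≡ ι m 1 ⊎ e ≡ ⊖_ m (ι m 1)) ×
  (t ≡ ι n (n / 4) ⊎ t ≡ ⊖_ n (ι n (n / 4)) ⊎ t ≡ ι n (n / 2))

next : (k : ℕ) .{{_ : NonZero k}} → Fin k → Fin k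
next k p = ι k (toℕ p + 1)

-- A C_k-factor of the graph (V, Adj): a spanning subgraph all of whose
-- components are k-cycles, given by a family of vertex-disjoint k-cycles
-- (cyc i 0, cyc i 1, …, cyc i (k-1)) covering every vertex exactly once.
record CFactor (V : Set) (Adj : V → V → Set) (k : ℕ) .{{_ : NonZero k}} : Set where
  field
    count      : ℕ
    cyc        : Fin count → Fin k → V
    adjacent   : ∀ i p → Adj (cyc i p) (cyc i (next k p))
    injective  : ∀ i j p q → cyc i p ≡ cyc j q → (i ≡ j × p ≡ q)
    surjective : ∀ v → ∃[ i ] ∃[ p ] (cyc i p ≡ v)

EdgeOf : {V : Set} {Adj : V → V → Set} {k : ℕ} .{{_ : NonZero k}} →
         CFactor V Adj k → V → V → Set
EdgeOf {k = k} F u v =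
  ∃[ i ] ∃[ p ] ((cyc i p ≡ u × cyc i (next k p) ≡ v) ⊎
                 (cyc i p ≡ v × cyc i (next k p) ≡ u))
  where open CFactor F

DecomposesInto : (V : Set) (Adj : V → V → Set) (r k : ℕ) .{{_ : NonZero k}} → Set
DecomposesInto V Adj r k =
  Σ[ F ∈ (Fin r → CFactor V Adj k) ]
    (∀ u v → Adj u v → ∃! _≡_ (λ (j : Fin r) → EdgeOf (F j) u v))

-- Write n = 4q, Q = q and H = 2q in ℤ_n, and let P y be the parity of the quarter ⌊y/q⌋
-- containing y, so that adding ±Q flips P while adding H keeps it.  A move of kind 0 adds Q
-- on even quarters and −Q on odd ones, kind 1 does the opposite, and kind 2 adds H; every
-- move is an involution, and from a given y the three kinds realise the three differences
-- Q, −Q, H exactly once.  Factor j leaves column x by the move of kind j + x for x < 3 and of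
-- kind j afterwards: the first three columns add 2(±Q) + H = 0 and the remaining m − 3
-- columns cancel in pairs, so each walk closes into an m-cycle, and every edge of the Cayley
-- graph is a move of exactly one factor (m ≥ 3 prevents an edge from being traversed
-- in both directions).
module Submission where

open import Algebra.Bundles using (AbelianGroup)
open import Algebra.Consequences.Propositional using (comm∧idˡ⇒id; comm∧invˡ⇒inv)
import Algebra.Properties.AbelianGroup as AbelianGroupProperties
open import Algebra.Structures using (IsAbelianGroup)
open import Data.Fin using (Fin; toℕ)
open import Data.Fin.Patterns using (0F; 1F; 2F)
open import Data.Fin.Properties using (toℕ-injective; toℕ-fromℕ<; toℕ<n)
open import Data.Nat
  using (ℕ; zero; suc; _+_; _*_; _∸_; _≤_; s≤s; z≤n; NonZero; >-nonZero⁻¹; ≢-nonZero⁻¹; parity)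
open import Data.Nat.DivMod
  using ( _%_; _/_; m%n<n; %-distribˡ-+; %-congʳ; m<n⇒m%n≡m; n%n≡0; m≡m%n+[m/n]*n; m*n/n≡m
        ; n/n≡1; m%[n*o]/o≡m/o%n; +-distrib-/-∣ʳ)
open import Data.Nat.Divisibility using (_∣_; divides; ∣-refl; ∣m∣n⇒∣m+n)
open import Data.Nat.Properties
  using ( +-assoc; +-comm; +-identityʳ; *-comm; *-assoc; *-distribˡ-+; *-monoʳ-<; m∸n+n≡m; <⇒≤
        ; m≤n⇒m<n∨m≡n; m*n≢0; m*n≢0⇒m≢0; m<m*n)
open import Data.Parity.Base as ℙ using (Parity; 0ℙ; 1ℙ)
import Data.Parity.Properties as ℙ
open import Data.Product using (_×_; _,_; proj₁; proj₂; ∃-syntax; ∃!)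
open import Data.Sum using (_⊎_; inj₁; inj₂)
open import Function using (_∘_)
open import Level using (0ℓ)
open import Relation.Binary.PropositionalEquality
  using (_≡_; _≢_; refl; sym; trans; cong; cong₂; subst; isEquivalence; module ≡-Reasoning)
open import Relation.Nullary using (¬_; contradiction)

open import Defs

module AbelianGroupIdentities {c ℓ} (G : AbelianGroup c ℓ) where

  open AbelianGroup G
  open AbelianGroupProperties G using (⁻¹-∙-comm; ⁻¹-anti-homo-//; //-rightDividesˡ; xyx⁻¹≈y)
  open import Relation.Binary.Reasoning.Setoid setoid

  x∙[x∙y]⁻¹≈y⁻¹ : ∀ x y → x ∙ (x ∙ y) ⁻¹ ≈ y ⁻¹
  x∙[x∙y]⁻¹≈y⁻¹ x y = begin
    x ∙ (x ∙ y) ⁻¹      ≈⟨ ∙-congˡ (⁻¹-∙-comm x y) ⟨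
    x ∙ (x ⁻¹ ∙ y ⁻¹)   ≈⟨ assoc x (x ⁻¹) (y ⁻¹) ⟨
    x ∙ x ⁻¹ ∙ y ⁻¹     ≈⟨ ∙-congʳ (inverseʳ x) ⟩
    ε ∙ y ⁻¹            ≈⟨ identityˡ (y ⁻¹) ⟩
    y ⁻¹                ∎

  y∙[x∙y⁻¹]≈x : ∀ x y → y ∙ (x ∙ y ⁻¹) ≈ x
  y∙[x∙y⁻¹]≈x x y = begin
    y ∙ (x ∙ y ⁻¹)      ≈⟨ comm y (x ∙ y ⁻¹) ⟩
    x ∙ y ⁻¹ ∙ y        ≈⟨ //-rightDividesˡ y x ⟩
    x                   ∎

  x∙[x∙y⁻¹]⁻¹≈y : ∀ x y → x ∙ (x ∙ y ⁻¹) ⁻¹ ≈ y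
  x∙[x∙y⁻¹]⁻¹≈y x y = begin
    x ∙ (x ∙ y ⁻¹) ⁻¹   ≈⟨ ∙-congˡ (⁻¹-anti-homo-// x y) ⟩
    x ∙ (y ∙ x ⁻¹)      ≈⟨ assoc x y (x ⁻¹) ⟨
    x ∙ y ∙ x ⁻¹        ≈⟨ xyx⁻¹≈y x y ⟩
    y                   ∎

module ZMod (k : ℕ) .{{_ : NonZero k}} where

  private
    infixl 6 _+ₖ_
    _+ₖ_ : Fin k → Fin k → Fin k
    _+ₖ_ = _⊕_ k

  toℕ-ι : ∀ x → toℕ (ι k x) ≡ x % k
  toℕ-ι x = toℕ-fromℕ< (m%n<n x k)

  ι-≡ : ∀ {x y} → x % k ≡ y % k → ι k x ≡ ι k y
  ι-≡ {x} {y} eq = toℕ-injective (trans (toℕ-ι x) (trans eq (sym (toℕ-ι y))))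

  ι-toℕ : ∀ a → ι k (toℕ a) ≡ a
  ι-toℕ a = toℕ-injective (trans (toℕ-ι (toℕ a)) (m<n⇒m%n≡m (toℕ<n a)))

  ι-homo-+ : ∀ x y → ι k (x + y) ≡ ι k x +ₖ ι k y
  ι-homo-+ x y = ι-≡ (begin
    (x + y) % k                        ≡⟨ %-distribˡ-+ x y k ⟩
    (x % k + y % k) % k                ≡⟨ cong₂ (λ a b → (a + b) % k) (toℕ-ι x) (toℕ-ι y) ⟨
    (toℕ (ι k x) + toℕ (ι k y)) % k    ∎)
    where open ≡-Reasoning

  0ₖ : Fin k
  0ₖ = ι k 0

  ι-k≡0 : ι k k ≡ 0ₖ
  ι-k≡0 = ι-≡ (trans (n%n≡0 k) (sym (m<n⇒m%n≡m (>-nonZero⁻¹ k))))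

  ⊕-comm : ∀ a b → a +ₖ b ≡ b +ₖ a
  ⊕-comm a b = cong (ι k) (+-comm (toℕ a) (toℕ b))

  ⊕-assoc : ∀ a b c → (a +ₖ b) +ₖ c ≡ a +ₖ (b +ₖ c)
  ⊕-assoc a b c = begin
    (a +ₖ b) +ₖ c                       ≡⟨ cong (ι k (toℕ a + toℕ b) +ₖ_) (ι-toℕ c) ⟨
    ι k (toℕ a + toℕ b) +ₖ ι k (toℕ c)  ≡⟨ ι-homo-+ (toℕ a + toℕ b) (toℕ c) ⟨
    ι k (toℕ a + toℕ b + toℕ c)         ≡⟨ cong (ι k) (+-assoc (toℕ a) (toℕ b) (toℕ c)) ⟩
    ι k (toℕ a + (toℕ b + toℕ c))       ≡⟨ ι-homo-+ (toℕ a) (toℕ b + toℕ c) ⟩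
    ι k (toℕ a) +ₖ (b +ₖ c)             ≡⟨ cong (_+ₖ (b +ₖ c)) (ι-toℕ a) ⟩
    a +ₖ (b +ₖ c)                       ∎
    where open ≡-Reasoning

  ⊕-identityˡ : ∀ a → 0ₖ +ₖ a ≡ a
  ⊕-identityˡ a = begin
    0ₖ +ₖ a            ≡⟨ cong (0ₖ +ₖ_) (ι-toℕ a) ⟨
    0ₖ +ₖ ι k (toℕ a)  ≡⟨ ι-homo-+ 0 (toℕ a) ⟨
    ι k (toℕ a)        ≡⟨ ι-toℕ a ⟩
    a                  ∎
    where open ≡-Reasoning

  ⊖-inverseˡ : ∀ a → ⊖_ k a +ₖ a ≡ 0ₖ
  ⊖-inverseˡ a = begin
    ⊖_ k a +ₖ a                     ≡⟨ cong (⊖_ k a +ₖ_) (ι-toℕ a) ⟨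
    ι k (k ∸ toℕ a) +ₖ ι k (toℕ a)  ≡⟨ ι-homo-+ (k ∸ toℕ a) (toℕ a) ⟨
    ι k (k ∸ toℕ a + toℕ a)         ≡⟨ cong (ι k) (m∸n+n≡m (<⇒≤ (toℕ<n a))) ⟩
    ι k k                           ≡⟨ ι-k≡0 ⟩
    0ₖ                              ∎
    where open ≡-Reasoning

  +-isAbelianGroup : IsAbelianGroup _≡_ _+ₖ_ 0ₖ (⊖_ k)
  +-isAbelianGroup = record
    { isGroup = record
      { isMonoid = record
        { isSemigroup = record
          { isMagma = record { isEquivalence = isEquivalence ; ∙-cong = cong₂ _+ₖ_ }
          ; assoc = ⊕-assoc }
        ; identity = comm∧idˡ⇒id ⊕-comm ⊕-identityˡ }
      ; inverse = comm∧invˡ⇒inv ⊕-comm ⊖-inverseˡ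
      ; ⁻¹-cong = cong (⊖_ k) }
    ; comm = ⊕-comm }

  +-abelianGroup : AbelianGroup 0ℓ 0ℓ
  +-abelianGroup = record { isAbelianGroup = +-isAbelianGroup }

  open AbelianGroup +-abelianGroup public
    using (_∙_; ε; _⁻¹; assoc; comm; identityʳ; inverseˡ; inverseʳ)
  open AbelianGroupProperties +-abelianGroup public
    using (∙-cancelˡ; ∙-cancelʳ; ⁻¹-involutive; ⁻¹-∙-comm; inverseʳ-unique; //-rightDividesˡ)
  open AbelianGroupIdentities +-abelianGroup public

  next≡∙1 : ∀ a → next k a ≡ a ∙ ι k 1
  next≡∙1 a = trans (ι-homo-+ (toℕ a) 1) (cong (_∙ ι k 1) (ι-toℕ a))

  a∙next[a]⁻¹≡1⁻¹ : ∀ a → a ∙ next k a ⁻¹ ≡ ι k 1 ⁻¹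
  a∙next[a]⁻¹≡1⁻¹ a = trans (cong (λ b → a ∙ b ⁻¹) (next≡∙1 a)) (x∙[x∙y]⁻¹≈y⁻¹ a (ι k 1))

  a∙b⁻¹≡1⇒a≡next[b] : ∀ {a b} → a ∙ b ⁻¹ ≡ ι k 1 → a ≡ next k b
  a∙b⁻¹≡1⇒a≡next[b] {a} {b} eq = begin
    a                  ≡⟨ y∙[x∙y⁻¹]≈x a b ⟨
    b ∙ (a ∙ b ⁻¹)     ≡⟨ cong (b ∙_) eq ⟩
    b ∙ ι k 1          ≡⟨ next≡∙1 b ⟨
    next k b           ∎
    where open ≡-Reasoning

  a∙b⁻¹≡1⁻¹⇒b≡next[a] : ∀ {a b} → a ∙ b ⁻¹ ≡ ι k 1 ⁻¹ → b ≡ next k a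
  a∙b⁻¹≡1⁻¹⇒b≡next[a] {a} {b} eq = begin
    b                  ≡⟨ x∙[x∙y⁻¹]⁻¹≈y a b ⟨
    a ∙ (a ∙ b ⁻¹) ⁻¹  ≡⟨ cong (λ c → a ∙ c ⁻¹) eq ⟩
    a ∙ ι k 1 ⁻¹ ⁻¹    ≡⟨ cong (a ∙_) (⁻¹-involutive (ι k 1)) ⟩
    a ∙ ι k 1          ≡⟨ next≡∙1 a ⟨
    next k a           ∎
    where open ≡-Reasoning

  next∘next≢id : 3 ≤ k → ∀ a → next k (next k a) ≢ a
  next∘next≢id 3≤k a eq = contradiction (begin
    2                  ≡⟨ m<n⇒m%n≡m 3≤k ⟨
    2 % k              ≡⟨ toℕ-ι 2 ⟨
    toℕ (ι k 2)        ≡⟨ cong toℕ ι2≡ε ⟩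
    toℕ ε              ≡⟨ toℕ-ι 0 ⟩
    0 % k              ≡⟨ m<n⇒m%n≡m (>-nonZero⁻¹ k) ⟩
    0                  ∎) λ ()
    where
    open ≡-Reasoning
    ι2≡ε : ι k 2 ≡ ε
    ι2≡ε = ∙-cancelˡ a _ _ (begin
      a ∙ ι k 2             ≡⟨ cong (a ∙_) (ι-homo-+ 1 1) ⟩
      a ∙ (ι k 1 ∙ ι k 1)   ≡⟨ assoc a _ _ ⟨
      a ∙ ι k 1 ∙ ι k 1     ≡⟨ trans (next≡∙1 (next k a)) (cong (_∙ ι k 1) (next≡∙1 a)) ⟨
      next k (next k a)     ≡⟨ eq ⟩
      a                     ≡⟨ identityʳ a ⟨
      a ∙ ε                 ∎)

-- C_m-factors from involutive column maps

walk : {A : Set} → (ℕ → A → A) → A → ℕ → A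
walk σ a zero    = a
walk σ a (suc x) = σ x (walk σ a x)

module Walk {A : Set} (σ : ℕ → A → A) (σ-involutive : ∀ x a → σ x (σ x a) ≡ a) where

  walkBack : A → ℕ → A
  walkBack a zero    = a
  walkBack a (suc x) = walkBack (σ x a) x

  walk-walkBack : ∀ x a → walk σ (walkBack a x) x ≡ a
  walk-walkBack zero    a = refl
  walk-walkBack (suc x) a = trans (cong (σ x) (walk-walkBack x (σ x a))) (σ-involutive x a)

  σ-injective : ∀ x {a b} → σ x a ≡ σ x b → a ≡ b
  σ-injective x {a} {b} eq = trans (sym (σ-involutive x a)) (trans (cong (σ x) eq) (σ-involutive x b))

  walk-injective : ∀ x {a b} → walk σ a x ≡ walk σ b x → a ≡ b
  walk-injective zero    eq = eq
  walk-injective (suc x) eq = walk-injective x (σ-injective x eq)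

advance : (m : ℕ) .{{_ : NonZero m}} {n : ℕ} → (ℕ → Fin n → Fin n) → Γ m n → Γ m n
advance m σ (x , w) = next m x , σ (toℕ x) w

Consecutive : (m : ℕ) .{{_ : NonZero m}} {n : ℕ} → (ℕ → Fin n → Fin n) → Γ m n → Γ m n → Set
Consecutive m σ u v = v ≡ advance m σ u ⊎ u ≡ advance m σ v

module ColumnFactor (m n : ℕ) .{{_ : NonZero m}}
    (σ : ℕ → Fin n → Fin n) (σ-involutive : ∀ x w → σ x (σ x w) ≡ w)
    (walk-closes : ∀ w → walk σ w m ≡ w) where

  open Walk σ σ-involutive

  cycle : Fin n → Fin m → Γ m n
  cycle w p = p , walk σ w (toℕ p)

  walk-%-≤ : ∀ w {x} → x ≤ m → walk σ w (x % m) ≡ walk σ w x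
  walk-%-≤ w x≤m with m≤n⇒m<n∨m≡n x≤m
  ... | inj₁ x<m  = cong (walk σ w) (m<n⇒m%n≡m x<m)
  ... | inj₂ refl = trans (cong (walk σ w) (n%n≡0 m)) (sym (walk-closes w))

  walk-next : ∀ w p → walk σ w (toℕ (next m p)) ≡ walk σ w (suc (toℕ p))
  walk-next w p = begin
    walk σ w (toℕ (next m p))    ≡⟨ cong (walk σ w) (ZMod.toℕ-ι m (toℕ p + 1)) ⟩
    walk σ w ((toℕ p + 1) % m)   ≡⟨ cong (λ x → walk σ w (x % m)) (+-comm (toℕ p) 1) ⟩
    walk σ w (suc (toℕ p) % m)   ≡⟨ walk-%-≤ w (toℕ<n p) ⟩
    walk σ w (suc (toℕ p))       ∎
    where open ≡-Reasoning

  cycle-next : ∀ w p → cycle w (next m p) ≡ advance m σ (cycle w p)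
  cycle-next w p = cong (next m p ,_) (walk-next w p)

  cycle-injective : ∀ w w' p p' → cycle w p ≡ cycle w' p' → w ≡ w' × p ≡ p'
  cycle-injective w w' p p' eq with cong proj₁ eq
  ... | refl = walk-injective (toℕ p) (cong proj₂ eq) , refl

  cycle-surjective : ∀ u → ∃[ w ] ∃[ p ] cycle w p ≡ u
  cycle-surjective (x , w) = walkBack w (toℕ x) , x , cong (x ,_) (walk-walkBack (toℕ x) w)

  module _ (Adj : Γ m n → Γ m n → Set) (adjacent : ∀ u → Adj u (advance m σ u)) where

    factor : CFactor (Γ m n) Adj m
    factor = record
      { count      = n
      ; cyc        = cycle
      ; adjacent   = λ w p → subst (Adj (cycle w p)) (sym (cycle-next w p)) (adjacent (cycle w p))
      ; injective  = cycle-injective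
      ; surjective = cycle-surjective
      }

    edge⇒consecutive : ∀ u v → EdgeOf factor u v → Consecutive m σ u v
    edge⇒consecutive u v (w , p , inj₁ (refl , refl)) = inj₁ (cycle-next w p)
    edge⇒consecutive u v (w , p , inj₂ (refl , refl)) = inj₂ (cycle-next w p)

    consecutive⇒edge : ∀ u v → Consecutive m σ u v → EdgeOf factor u v
    consecutive⇒edge u v (inj₁ refl) with cycle-surjective u
    ... | w , p , refl = w , p , inj₁ (refl , cycle-next w p)
    consecutive⇒edge u v (inj₂ refl) with cycle-surjective v
    ... | w , p , refl = w , p , inj₂ (refl , cycle-next w p)

module ColumnDecomposition (m n r : ℕ) .{{_ : NonZero m}} (3≤m : 3 ≤ m)
    (σ : Fin r → ℕ → Fin n → Fin n) (σ-involutive : ∀ j x w → σ j x (σ j x w) ≡ w)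
    (walk-closes : ∀ j w → walk (σ j) w m ≡ w)
    (σ-separates : ∀ {j j'} x w → σ j x w ≡ σ j' x w → j ≡ j')
    (Adj : Γ m n → Γ m n → Set) (adjacent : ∀ j u → Adj u (advance m (σ j) u)) where

  module Factor (j : Fin r) = ColumnFactor m n (σ j) (σ-involutive j) (walk-closes j)

  consecutive-unique : ∀ {j j' u v} → Consecutive m (σ j) u v → Consecutive m (σ j') u v → j ≡ j'
  consecutive-unique {u = x , w} (inj₁ refl) (inj₁ eq) = σ-separates (toℕ x) w (cong proj₂ eq)
  consecutive-unique {v = x , w} (inj₂ refl) (inj₂ eq) = σ-separates (toℕ x) w (cong proj₂ eq)
  consecutive-unique {u = x , _} (inj₁ refl) (inj₂ eq) =
    contradiction (sym (cong proj₁ eq)) (ZMod.next∘next≢id m 3≤m x)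
  consecutive-unique {v = x , _} (inj₂ refl) (inj₁ eq) =
    contradiction (sym (cong proj₁ eq)) (ZMod.next∘next≢id m 3≤m x)

  decomposition : (∀ u v → Adj u v → ∃[ j ] Consecutive m (σ j) u v) → DecomposesInto (Γ m n) Adj r m
  decomposition covered = factor , unique-factor
    where
    factor : Fin r → CFactor (Γ m n) Adj m
    factor j = Factor.factor j Adj (adjacent j)

    unique-factor : ∀ u v → Adj u v → ∃! _≡_ (λ j → EdgeOf (factor j) u v)
    unique-factor u v adj with covered u v adj
    ... | j , c = j , Factor.consecutive⇒edge j Adj (adjacent j) u v c ,
                  λ e → consecutive-unique c (Factor.edge⇒consecutive _ Adj (adjacent _) u v e)

-- The quarters of ℤ_4q

parity-% : ∀ x d .{{_ : NonZero d}} → parity d ≡ 0ℙ → parity (x % d) ≡ parity x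
parity-% x d even = sym (begin
  parity x                                          ≡⟨ cong parity (m≡m%n+[m/n]*n x d) ⟩
  parity (x % d + x / d * d)                        ≡⟨ ℙ.+-homo-+ (x % d) (x / d * d) ⟩
  parity (x % d) ℙ.+ parity (x / d * d)             ≡⟨ cong (parity (x % d) ℙ.+_) (ℙ.*-homo-* (x / d) d) ⟩
  parity (x % d) ℙ.+ (parity (x / d) ℙ.* parity d)  ≡⟨ cong (λ p → parity (x % d) ℙ.+ (parity (x / d) ℙ.* p)) even ⟩
  parity (x % d) ℙ.+ (parity (x / d) ℙ.* 0ℙ)        ≡⟨ cong (parity (x % d) ℙ.+_) (ℙ.*-zeroʳ (parity (x / d))) ⟩
  parity (x % d) ℙ.+ 0ℙ                             ≡⟨ ℙ.+-identityʳ (parity (x % d)) ⟩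
  parity (x % d)                                    ∎)
  where open ≡-Reasoning

module QuarterTurn (q : ℕ) .{{_ : NonZero q}} where

  private
    n : ℕ
    n = q * 4

    instance
      n≢0 : NonZero n
      n≢0 = m*n≢0 q 4
      4q≢0 : NonZero (4 * q)
      4q≢0 = m*n≢0 4 q

  open ZMod n

  Q H : Fin n
  Q = ι n (n / 4)
  H = ι n (n / 2)

  Q≡ι[q] : Q ≡ ι n q
  Q≡ι[q] = cong (ι n) (m*n/n≡m q 4)

  H≡ι[2q] : H ≡ ι n (q * 2)
  H≡ι[2q] = cong (ι n) (trans (cong (_/ 2) (sym (*-assoc q 2 2))) (m*n/n≡m (q * 2) 2))

  toℕ-Q : toℕ Q ≡ q
  toℕ-Q = trans (cong toℕ Q≡ι[q]) (trans (toℕ-ι q) (m<n⇒m%n≡m (m<m*n q 4 (s≤s (s≤s z≤n)))))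

  Q∙Q≡H : Q ∙ Q ≡ H
  Q∙Q≡H = begin
    Q ∙ Q              ≡⟨ cong₂ _∙_ Q≡ι[q] Q≡ι[q] ⟩
    ι n q ∙ ι n q      ≡⟨ ι-homo-+ q q ⟨
    ι n (q + q)        ≡⟨ cong (ι n) (trans (cong (q +_) (sym (+-identityʳ q))) (*-comm 2 q)) ⟩
    ι n (q * 2)        ≡⟨ H≡ι[2q] ⟨
    H                  ∎
    where open ≡-Reasoning

  H∙H≡ε : H ∙ H ≡ ε
  H∙H≡ε = begin
    H ∙ H                        ≡⟨ cong₂ _∙_ H≡ι[2q] H≡ι[2q] ⟩
    ι n (q * 2) ∙ ι n (q * 2)    ≡⟨ ι-homo-+ (q * 2) (q * 2) ⟨
    ι n (q * 2 + q * 2)          ≡⟨ cong (ι n) (*-distribˡ-+ q 2 2) ⟨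
    ι n n                        ≡⟨ ι-k≡0 ⟩
    ε                            ∎
    where open ≡-Reasoning

  H⁻¹≡H : H ⁻¹ ≡ H
  H⁻¹≡H = sym (inverseʳ-unique H H H∙H≡ε)

  Q⁻¹∙Q⁻¹≡H : Q ⁻¹ ∙ Q ⁻¹ ≡ H
  Q⁻¹∙Q⁻¹≡H = trans (⁻¹-∙-comm Q Q) (trans (cong _⁻¹ Q∙Q≡H) H⁻¹≡H)

  H≢ε : H ≢ ε
  H≢ε eq = ≢-nonZero⁻¹ (q * 2) {{m*n≢0 q 2}} (begin
    q * 2              ≡⟨ m<n⇒m%n≡m (*-monoʳ-< q (s≤s (s≤s (s≤s z≤n)))) ⟨
    q * 2 % n          ≡⟨ toℕ-ι (q * 2) ⟨
    toℕ (ι n (q * 2))  ≡⟨ cong toℕ (trans (sym H≡ι[2q]) eq) ⟩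
    toℕ ε              ≡⟨ toℕ-ι 0 ⟩
    0 % n              ≡⟨ m<n⇒m%n≡m (>-nonZero⁻¹ n) ⟩
    0                  ∎)
    where open ≡-Reasoning

  Q≢Q⁻¹ : Q ≢ Q ⁻¹
  Q≢Q⁻¹ eq = H≢ε (trans (sym Q∙Q≡H) (trans (cong (Q ∙_) eq) (inverseʳ Q)))

  P : Fin n → Parity
  P y = parity (toℕ y / q)

  P-∙Q : ∀ y → P (y ∙ Q) ≡ P y ℙ.⁻¹
  P-∙Q y = begin
    parity (toℕ (y ∙ Q) / q)           ≡⟨ cong (λ t → parity (t / q)) (toℕ-ι (toℕ y + toℕ Q)) ⟩
    parity ((toℕ y + toℕ Q) % n / q)   ≡⟨ cong (λ t → parity ((toℕ y + t) % n / q)) toℕ-Q ⟩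
    parity ((Y + q) % (q * 4) / q)     ≡⟨ cong (λ t → parity (t / q)) (%-congʳ (*-comm q 4)) ⟩
    parity ((Y + q) % (4 * q) / q)     ≡⟨ cong parity (m%[n*o]/o≡m/o%n (Y + q) 4 q) ⟩
    parity ((Y + q) / q % 4)           ≡⟨ parity-% ((Y + q) / q) 4 refl ⟩
    parity ((Y + q) / q)               ≡⟨ cong parity (+-distrib-/-∣ʳ Y (∣-refl {q})) ⟩
    parity (Y / q + q / q)             ≡⟨ cong (λ t → parity (Y / q + t)) (n/n≡1 q) ⟩
    parity (Y / q + 1)                 ≡⟨ cong parity (+-comm (Y / q) 1) ⟩
    parity (suc (Y / q))               ≡⟨ ℙ.⁻¹-selfInverse (ℙ.suc-homo-⁻¹ (Y / q)) ⟨
    parity (Y / q) ℙ.⁻¹                ∎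
    where
    open ≡-Reasoning
    Y : ℕ
    Y = toℕ y

  P-∙Q⁻¹ : ∀ y → P (y ∙ Q ⁻¹) ≡ P y ℙ.⁻¹
  P-∙Q⁻¹ y = begin
    P (y ∙ Q ⁻¹)                 ≡⟨ ℙ.⁻¹-involutive (P (y ∙ Q ⁻¹)) ⟨
    P (y ∙ Q ⁻¹) ℙ.⁻¹ ℙ.⁻¹       ≡⟨ cong ℙ._⁻¹ (P-∙Q (y ∙ Q ⁻¹)) ⟨
    P (y ∙ Q ⁻¹ ∙ Q) ℙ.⁻¹        ≡⟨ cong (λ z → P z ℙ.⁻¹) (//-rightDividesˡ Q y) ⟩
    P y ℙ.⁻¹                     ∎
    where open ≡-Reasoning

  turning≢steady : ∀ {s t} → (∀ y → P (y ∙ s) ≡ P y ℙ.⁻¹) → (∀ y → P (y ∙ t) ≡ P y) → s ≢ t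
  turning≢steady {s} {t} P-∙s P-∙t s≡t = ℙ.p≢p⁻¹ (P ε) (begin
    P ε             ≡⟨ P-∙t ε ⟨
    P (ε ∙ t)       ≡⟨ cong (λ r → P (ε ∙ r)) s≡t ⟨
    P (ε ∙ s)       ≡⟨ P-∙s ε ⟩
    P ε ℙ.⁻¹        ∎)
    where open ≡-Reasoning

  P-∙H : ∀ y → P (y ∙ H) ≡ P y
  P-∙H y = begin
    P (y ∙ H)            ≡⟨ cong (λ h → P (y ∙ h)) Q∙Q≡H ⟨
    P (y ∙ (Q ∙ Q))      ≡⟨ cong P (assoc y Q Q) ⟨
    P (y ∙ Q ∙ Q)        ≡⟨ P-∙Q (y ∙ Q) ⟩
    P (y ∙ Q) ℙ.⁻¹       ≡⟨ cong ℙ._⁻¹ (P-∙Q y) ⟩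
    P y ℙ.⁻¹ ℙ.⁻¹        ≡⟨ ℙ.⁻¹-involutive (P y) ⟩
    P y                  ∎
    where open ≡-Reasoning

  Q≢H : Q ≢ H
  Q≢H = turning≢steady P-∙Q P-∙H

  Q⁻¹≢H : Q ⁻¹ ≢ H
  Q⁻¹≢H = turning≢steady P-∙Q⁻¹ P-∙H

  T : Fin n → Set
  T t = t ≡ Q ⊎ t ≡ Q ⁻¹ ⊎ t ≡ H

  T-⁻¹ : ∀ {t} → T t → T (t ⁻¹)
  T-⁻¹ (inj₁ refl)        = inj₂ (inj₁ refl)
  T-⁻¹ (inj₂ (inj₁ refl)) = inj₁ (⁻¹-involutive Q)
  T-⁻¹ (inj₂ (inj₂ refl)) = inj₂ (inj₂ H⁻¹≡H)

module Moves (q : ℕ) .{{_ : NonZero q}} where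

  private
    n : ℕ
    n = q * 4

    instance
      n≢0 : NonZero n
      n≢0 = m*n≢0 q 4

  open ZMod n
  open QuarterTurn q

  step : Fin 3 → Parity → Fin n
  step 0F 0ℙ = Q
  step 0F 1ℙ = Q ⁻¹
  step 1F 0ℙ = Q ⁻¹
  step 1F 1ℙ = Q
  step 2F _  = H

  turn : Fin 3 → Parity → Parity
  turn 0F p = p ℙ.⁻¹
  turn 1F p = p ℙ.⁻¹
  turn 2F p = p

  T-step : ∀ k p → T (step k p)
  T-step 0F 0ℙ = inj₁ refl
  T-step 0F 1ℙ = inj₂ (inj₁ refl)
  T-step 1F 0ℙ = inj₂ (inj₁ refl)
  T-step 1F 1ℙ = inj₁ refl
  T-step 2F _  = inj₂ (inj₂ refl)

  step-surjective : ∀ p {t} → T t → ∃[ k ] step k p ≡ t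
  step-surjective 0ℙ (inj₁ refl)        = 0F , refl
  step-surjective 1ℙ (inj₁ refl)        = 1F , refl
  step-surjective 0ℙ (inj₂ (inj₁ refl)) = 1F , refl
  step-surjective 1ℙ (inj₂ (inj₁ refl)) = 0F , refl
  step-surjective _  (inj₂ (inj₂ refl)) = 2F , refl

  step-injective : ∀ p {k k'} → step k p ≡ step k' p → k ≡ k'
  step-injective _  {0F} {0F} _  = refl
  step-injective _  {1F} {1F} _  = refl
  step-injective _  {2F} {2F} _  = refl
  step-injective 0ℙ {0F} {1F} eq = contradiction eq Q≢Q⁻¹
  step-injective 1ℙ {0F} {1F} eq = contradiction (sym eq) Q≢Q⁻¹
  step-injective 0ℙ {1F} {0F} eq = contradiction (sym eq) Q≢Q⁻¹
  step-injective 1ℙ {1F} {0F} eq = contradiction eq Q≢Q⁻¹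
  step-injective 0ℙ {0F} {2F} eq = contradiction eq Q≢H
  step-injective 1ℙ {0F} {2F} eq = contradiction eq Q⁻¹≢H
  step-injective 0ℙ {1F} {2F} eq = contradiction eq Q⁻¹≢H
  step-injective 1ℙ {1F} {2F} eq = contradiction eq Q≢H
  step-injective 0ℙ {2F} {0F} eq = contradiction (sym eq) Q≢H
  step-injective 1ℙ {2F} {0F} eq = contradiction (sym eq) Q⁻¹≢H
  step-injective 0ℙ {2F} {1F} eq = contradiction (sym eq) Q⁻¹≢H
  step-injective 1ℙ {2F} {1F} eq = contradiction (sym eq) Q≢H

  P-∙step : ∀ k p y → P (y ∙ step k p) ≡ turn k (P y)
  P-∙step 0F 0ℙ = P-∙Q
  P-∙step 0F 1ℙ = P-∙Q⁻¹
  P-∙step 1F 0ℙ = P-∙Q⁻¹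
  P-∙step 1F 1ℙ = P-∙Q
  P-∙step 2F _  = P-∙H

  step∙step-turn : ∀ k p → step k p ∙ step k (turn k p) ≡ ε
  step∙step-turn 0F 0ℙ = inverseʳ Q
  step∙step-turn 0F 1ℙ = inverseˡ Q
  step∙step-turn 1F 0ℙ = inverseˡ Q
  step∙step-turn 1F 1ℙ = inverseʳ Q
  step∙step-turn 2F _  = H∙H≡ε

  move : Fin 3 → Fin n → Fin n
  move k y = y ∙ step k (P y)

  P-move : ∀ k y → P (move k y) ≡ turn k (P y)
  P-move k y = P-∙step k (P y) y

  move-involutive : ∀ k y → move k (move k y) ≡ y
  move-involutive k y = begin
    move k (move k y)                           ≡⟨ cong (λ p → y ∙ step k (P y) ∙ step k p) (P-move k y) ⟩
    y ∙ step k (P y) ∙ step k (turn k (P y))    ≡⟨ assoc y _ _ ⟩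
    y ∙ (step k (P y) ∙ step k (turn k (P y)))  ≡⟨ cong (y ∙_) (step∙step-turn k (P y)) ⟩
    y ∙ ε                                       ≡⟨ identityʳ y ⟩
    y                                           ∎
    where open ≡-Reasoning

  offset : ℕ → Fin 3
  offset 0                   = 0F
  offset 1                   = 1F
  offset 2                   = 2F
  offset (suc (suc (suc _))) = 0F

  kind : Fin 3 → ℕ → Fin 3
  kind j x = _⊕_ 3 j (offset x)

  kind-injective : ∀ x {j j'} → kind j x ≡ kind j' x → j ≡ j'
  kind-injective x = ZMod.∙-cancelʳ 3 (offset x) _ _

  kind-surjective : ∀ x k → ∃[ j ] kind j x ≡ k
  kind-surjective x k = _⊝_ 3 k (offset x) , ZMod.//-rightDividesˡ 3 (offset x) k

  σ : Fin 3 → ℕ → Fin n → Fin n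
  σ j x = move (kind j x)

  move∘move∘move : ∀ k₁ k₂ k₃ y → let p = P y in
    move k₃ (move k₂ (move k₁ y)) ≡ y ∙ (step k₁ p ∙ step k₂ (turn k₁ p) ∙ step k₃ (turn k₂ (turn k₁ p)))
  move∘move∘move k₁ k₂ k₃ y = begin
    move k₃ (move k₂ (move k₁ y))   ≡⟨ cong (λ p → move k₂ (move k₁ y) ∙ step k₃ p)
                                           (trans (P-move k₂ (move k₁ y)) (cong (turn k₂) (P-move k₁ y))) ⟩
    move k₂ (move k₁ y) ∙ c         ≡⟨ cong (λ p → y ∙ a ∙ step k₂ p ∙ c) (P-move k₁ y) ⟩
    y ∙ a ∙ b ∙ c                   ≡⟨ assoc (y ∙ a) b c ⟩
    y ∙ a ∙ (b ∙ c)                 ≡⟨ assoc y a (b ∙ c) ⟩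
    y ∙ (a ∙ (b ∙ c))               ≡⟨ cong (y ∙_) (assoc a b c) ⟨
    y ∙ (a ∙ b ∙ c)                 ∎
    where
    open ≡-Reasoning
    p : Parity
    p = P y
    a b c : Fin n
    a = step k₁ p
    b = step k₂ (turn k₁ p)
    c = step k₃ (turn k₂ (turn k₁ p))

  s∙s∙H≡ε : ∀ s → s ∙ s ≡ H → s ∙ s ∙ H ≡ ε
  s∙s∙H≡ε s s∙s≡H = trans (cong (_∙ H) s∙s≡H) H∙H≡ε

  s∙H∙s≡ε : ∀ s → s ∙ s ≡ H → s ∙ H ∙ s ≡ ε
  s∙H∙s≡ε s s∙s≡H = begin
    s ∙ H ∙ s      ≡⟨ assoc s H s ⟩
    s ∙ (H ∙ s)    ≡⟨ cong (s ∙_) (comm H s) ⟩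
    s ∙ (s ∙ H)    ≡⟨ assoc s s H ⟨
    s ∙ s ∙ H      ≡⟨ s∙s∙H≡ε s s∙s≡H ⟩
    ε              ∎
    where open ≡-Reasoning

  H∙s∙s≡ε : ∀ s → s ∙ s ≡ H → H ∙ s ∙ s ≡ ε
  H∙s∙s≡ε s s∙s≡H = trans (assoc H s s) (trans (cong (H ∙_) s∙s≡H) H∙H≡ε)

  -- The two ±Q-steps of a round have the same sign, as exactly one parity turn separates them.
  round-sum : ∀ j p → let k = kind j in
    step (k 0) p ∙ step (k 1) (turn (k 0) p) ∙ step (k 2) (turn (k 1) (turn (k 0) p)) ≡ ε
  round-sum 0F 0ℙ = s∙s∙H≡ε Q Q∙Q≡H
  round-sum 0F 1ℙ = s∙s∙H≡ε (Q ⁻¹) Q⁻¹∙Q⁻¹≡H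
  round-sum 1F 0ℙ = s∙H∙s≡ε (Q ⁻¹) Q⁻¹∙Q⁻¹≡H
  round-sum 1F 1ℙ = s∙H∙s≡ε Q Q∙Q≡H
  round-sum 2F 0ℙ = H∙s∙s≡ε Q Q∙Q≡H
  round-sum 2F 1ℙ = H∙s∙s≡ε (Q ⁻¹) Q⁻¹∙Q⁻¹≡H

  walk-3 : ∀ j y → walk (σ j) y 3 ≡ y
  walk-3 j y = trans (move∘move∘move (kind j 0) (kind j 1) (kind j 2) y)
                     (trans (cong (y ∙_) (round-sum j (P y))) (identityʳ y))

  walk-odd : ∀ j y x → 3 ≤ x → ¬ 2 ∣ x → walk (σ j) y x ≡ y
  walk-odd j y 1 (s≤s ()) _
  walk-odd j y 2 (s≤s (s≤s ())) _
  walk-odd j y 3 _ _ = walk-3 j y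
  walk-odd j y 4 _ odd = contradiction (divides 2 refl) odd
  -- From column 3 on every column has kind j, so consecutive moves cancel.
  walk-odd j y (suc (suc x@(suc (suc (suc _))))) _ odd =
    trans (move-involutive (kind j x) (walk (σ j) y x))
          (walk-odd j y x (s≤s (s≤s (s≤s z≤n))) (odd ∘ ∣m∣n⇒∣m+n (∣-refl {2})))

module CayleyFactors (m : ℕ) .{{_ : NonZero m}} (q : ℕ) .{{_ : NonZero q}} where

  private
    n : ℕ
    n = q * 4

    instance
      n≢0 : NonZero n
      n≢0 = m*n≢0 q 4

  open ZMod n using (_∙_; _⁻¹; ∙-cancelˡ; x∙[x∙y]⁻¹≈y⁻¹; y∙[x∙y⁻¹]≈x; x∙[x∙y⁻¹]⁻¹≈y)
  open QuarterTurn q using (P; T; T-⁻¹)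
  open Moves q
  module ℤₘ = ZMod m

  Adj : Γ m n → Γ m n → Set
  Adj = Cay m n (S-pm1×T m n)

  advance-adjacent : ∀ j u → Adj u (advance m (σ j) u)
  advance-adjacent j (x , w) =
    inj₂ (ℤₘ.a∙next[a]⁻¹≡1⁻¹ x) ,
    subst T (sym (x∙[x∙y]⁻¹≈y⁻¹ w _)) (T-⁻¹ (T-step (kind j (toℕ x)) (P w)))

  advance-by : ∀ x w {t} → T t → ∃[ j ] advance m (σ j) (x , w) ≡ (next m x , w ∙ t)
  advance-by x w t∈T with step-surjective (P w) t∈T
  ... | k , refl with kind-surjective (toℕ x) k
  ... | j , refl = j , refl

  adjacent⇒consecutive : ∀ u v → Adj u v → ∃[ j ] Consecutive m (σ j) u v
  adjacent⇒consecutive (x , w) (x' , w') (inj₂ x∙x'⁻¹≡1⁻¹ , t) with advance-by x w (T-⁻¹ t)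
  ... | j , eq = j , inj₁ (trans v≡ (sym eq))
    where
    v≡ : (x' , w') ≡ (next m x , w ∙ (w ∙ w' ⁻¹) ⁻¹)
    v≡ = cong₂ _,_ (ℤₘ.a∙b⁻¹≡1⁻¹⇒b≡next[a] x∙x'⁻¹≡1⁻¹) (sym (x∙[x∙y⁻¹]⁻¹≈y w w'))
  adjacent⇒consecutive (x , w) (x' , w') (inj₁ x∙x'⁻¹≡1 , t) with advance-by x' w' t
  ... | j , eq = j , inj₂ (trans u≡ (sym eq))
    where
    u≡ : (x , w) ≡ (next m x' , w' ∙ (w ∙ w' ⁻¹))
    u≡ = cong₂ _,_ (ℤₘ.a∙b⁻¹≡1⇒a≡next[b] x∙x'⁻¹≡1) (sym (y∙[x∙y⁻¹]≈x w w'))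

  σ-separates : ∀ {j j'} x w → σ j x w ≡ σ j' x w → j ≡ j'
  σ-separates x w eq = kind-injective x (step-injective (P w) (∙-cancelˡ w _ _ eq))

  decomposition : 3 ≤ m → ¬ 2 ∣ m → DecomposesInto (Γ m n) Adj 3 m
  decomposition 3≤m m-odd =
    ColumnDecomposition.decomposition m n 3 3≤m σ (λ j x → move-involutive (kind j x))
      (λ j w → walk-odd j w m 3≤m m-odd) σ-separates Adj advance-adjacent adjacent⇒consecutive

lemma2p6 : (m n : ℕ) .{{_ : NonZero m}} .{{_ : NonZero n}} →
           3 ≤ m → ¬ (2 ∣ m) → 4 ∣ n →
           DecomposesInto (Γ m n) (Cay m n (S-pm1×T m n)) 3 m
lemma2p6 m .(q * 4) 3≤m m-odd (divides q refl) =
  CayleyFactors.decomposition m q {{m*n≢0⇒m≢0 q}} 3≤m m-odd
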